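{- If a connected graph is $(1,2)$-step competition-realizable, then it has a vertex of degree at least three.
   Context: For vertices $x,y$ of a digraph $H$, $d_H(x,y)$ is the length of a shortest directed $(x,y)$-path. The $(1,2)$-step competition graph $C_{1,2}(D)$ of a digraph $D$ is the simple graph on $V(D)$ in which distinct $u,v$ are adjacent iff there is $w\neq u,v$ with either $d_{D-v}(u,w)\le 1$ and $d_{D-u}(v,w)\le 2$, or $d_{D-u}(v,w)\le 1$ and $d_{D-v}(u,w)\le 2$. A graph is $(1,2)$-step competition-realizable if it is isomorphic to $C_{1,2}(D)$ for some orientation $D$ of a complete bipartite graph $K_{m,n}$ with $m,n\ge1$. -}

module Defs where

open import Data.Nat using (ℕ; zero; suc; _≥_; _≤_)
open import Data.Fin using (Fin)
open import Data.Bool using (Bool; true; false; not; T)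
open import Data.Sum using (_⊎_; inj₁; inj₂)
open import Data.Product using (Σ; ∃; ∃-syntax; _×_; _,_)
open import Data.List using (List; length; filterᵇ; allFin)
open import Data.Empty using (⊥)
open import Relation.Nullary using (¬_)
open import Relation.Binary.PropositionalEquality using (_≡_; _≢_)
open import Relation.Binary.Construct.Closure.ReflexiveTransitive using (Star)
open import Function.Bundles using (_↔_; Inverse)

record Graph (k : ℕ) : Set where
  field
    adj    : Fin k → Fin k → Bool
    sym    : ∀ x y → adj x y ≡ adj y x
    irrefl : ∀ x → adj x x ≡ false

open Graph public

Adj : ∀ {k} → Graph k → Fin k → Fin k → Set
Adj G x y = T (adj G x y)

degree : ∀ {k} → Graph k → Fin k → ℕ
degree G x = length (filterᵇ (adj G x) (allFin _))

Connected : ∀ {k} → Graph k → Set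
Connected G = ∀ x y → Star (Adj G) x y

Digraph : Set → Set₁
Digraph V = V → V → Set

-- WithinSteps D z k a b : there is a directed walk of length ≤ k from a
-- to b in D - z (all its vertices differ from z).  This holds iff
-- d_{D-z}(a,b) ≤ k (with a, b vertices of D - z).
data WithinSteps {V : Set} (D : Digraph V) (z : V) : ℕ → V → V → Set where
  here : ∀ {k a} → a ≢ z → WithinSteps D z k a a
  step : ∀ {k a b c} → a ≢ z → D a b → WithinSteps D z k b c →
         WithinSteps D z (suc k) a c

C12 : ∀ {V : Set} → Digraph V → V → V → Set
C12 {V} D u v =
  u ≢ v ×
  ∃[ w ] (w ≢ u × w ≢ v ×
    ((WithinSteps D v 1 u w × WithinSteps D u 2 v w)
     ⊎ (WithinSteps D u 1 v w × WithinSteps D v 2 u w)))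

-- Orientation of K_{m,n} with parts Fin m and Fin n:
-- o i j = true means the arc i → j, false means the arc j → i.
Orientation : ℕ → ℕ → Set
Orientation m n = Fin m → Fin n → Bool

orientArc : ∀ {m n} → Orientation m n → Digraph (Fin m ⊎ Fin n)
orientArc o (inj₁ i) (inj₂ j) = T (o i j)
orientArc o (inj₂ j) (inj₁ i) = T (not (o i j))
orientArc o (inj₁ _) (inj₁ _) = ⊥
orientArc o (inj₂ _) (inj₂ _) = ⊥

Realizable : ∀ {k} → Graph k → Set
Realizable {k} G =
  ∃[ m ] ∃[ n ] (m ≥ 1 × n ≥ 1 × Σ (Orientation m n) λ o →
    Σ (Fin k ↔ (Fin m ⊎ Fin n)) λ f →
      ∀ x y → (Adj G x y → C12 (orientArc o) (Inverse.to f x) (Inverse.to f y))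
            × (C12 (orientArc o) (Inverse.to f x) (Inverse.to f y) → Adj G x y))

-- In an orientation of K_{m,n}, two vertices with a common out-neighbour are
-- adjacent in C_{1,2}, and so are v and z whenever v → y → w and z → w with
-- y ≠ z.  Connectivity provides a vertex w with two in-neighbours y, z and a
-- C_{1,2}-edge at w, which exhibits one of two configurations.  Either some
-- out-neighbour t of w has a second in-neighbour x, and then x is adjacent to
-- w, y and z; or w → p → f ← p' with p ≠ p'.  In the latter case w and p' lie
-- in different parts: if p' → w, then p' is adjacent to p, w and to whichever
-- of y, z differs from p'; if w → p', then w, p, p' form a triangle, and the
-- walk from w to that in-neighbour of w must leave the triangle through a
-- vertex of degree three.
module Submission where

open import Defs hiding (sym)
open import Data.Nat using (ℕ; _≥_; _≤_; s≤s)
open import Data.Fin using (Fin)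
import Data.Fin as Fin
open import Data.Bool using (true; false; not; T)
open import Data.Unit using (tt)
open import Data.Empty using (⊥-elim)
open import Data.Product using (∃-syntax; _×_; _,_; proj₁; proj₂)
open import Data.Sum using (_⊎_; inj₁; inj₂)
open import Data.Sum.Properties using (≡-dec)
open import Data.List using (List; []; _∷_; length; filterᵇ; allFin)
open import Data.List.Relation.Unary.Any using (here; there)
open import Data.List.Membership.Propositional using (_∈_; _∉_)
open import Data.List.Membership.Propositional.Properties
  using (∈-length; ∈-allFin; ∈-filter⁺)
open import Relation.Nullary using (¬_; yes; no)
open import Relation.Nullary.Decidable using (T?)
open import Relation.Unary using (Decidable)
open import Relation.Binary.Definitions using (DecidableEquality; Symmetric; Irreflexive)
open import Relation.Binary.PropositionalEquality
  using (_≡_; _≢_; refl; sym; trans; cong; subst₂; ≢-sym)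
open import Relation.Binary.Construct.Closure.ReflexiveTransitive
  using (Star; ε; _◅_; gmap)
open import Function.Bundles using (_↔_; Inverse)

2≤length : ∀ {A : Set} {a b : A} {xs : List A} → a ∈ xs → b ∈ xs → a ≢ b →
           2 ≤ length xs
2≤length (here a≡x) (here b≡x) a≢b = ⊥-elim (a≢b (trans a≡x (sym b≡x)))
2≤length (here _)   (there b∈) _   = s≤s (∈-length b∈)
2≤length (there a∈) _          _   = s≤s (∈-length a∈)

3≤length : ∀ {A : Set} {a b c : A} {xs : List A} → a ∈ xs → b ∈ xs → c ∈ xs →
           a ≢ b → a ≢ c → b ≢ c → 3 ≤ length xs
3≤length (here a≡x) (here b≡x) _ a≢b _ _ = ⊥-elim (a≢b (trans a≡x (sym b≡x)))
3≤length (here a≡x) (there _) (here c≡x) _ a≢c _ = ⊥-elim (a≢c (trans a≡x (sym c≡x)))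
3≤length (there _) (here b≡x) (here c≡x) _ _ b≢c = ⊥-elim (b≢c (trans b≡x (sym c≡x)))
3≤length (here _)   (there b∈) (there c∈) _   _   b≢c = s≤s (2≤length b∈ c∈ b≢c)
3≤length (there a∈) (here _)   (there c∈) _   a≢c _   = s≤s (2≤length a∈ c∈ a≢c)
3≤length (there a∈) (there b∈) _          a≢b _   _   = s≤s (2≤length a∈ b∈ a≢b)

ThreeNeighbours : ∀ {V : Set} → (V → V → Set) → V → Set
ThreeNeighbours N u = ∃[ a ] ∃[ b ] ∃[ c ]
  (N u a × N u b × N u c × a ≢ b × a ≢ c × b ≢ c)

∈∉⇒≢ : ∀ {A : Set} {x t : A} {xs : List A} → x ∈ xs → t ∉ xs → x ≢ t
∈∉⇒≢ x∈ t∉ refl = t∉ x∈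

Star-first : ∀ {V : Set} {R : V → V → Set} {a b} → Star R a b → a ≢ b → ∃[ x ] R a x
Star-first ε        a≢a = ⊥-elim (a≢a refl)
Star-first (ax ◅ _) _   = _ , ax

Star-exits : ∀ {V : Set} {R : V → V → Set} {P : V → Set} → Decidable P →
             ∀ {a b} → Star R a b → P a → ¬ P b →
             ∃[ s ] ∃[ t ] (P s × ¬ P t × R s t)
Star-exits P? ε                    Pa ¬Pb = ⊥-elim (¬Pb Pa)
Star-exits P? (_◅_ {j = x} r rest) Pa ¬Pb with P? x
... | yes Px = Star-exits P? rest Px ¬Pb
... | no ¬Px = _ , x , Pa , ¬Px , r

module _ {V : Set} {N : V → V → Set}
         (N-sym : Symmetric N) (N-irrefl : Irreflexive _≡_ N) (_≟_ : DecidableEquality V)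
         where

  open import Data.List.Membership.DecPropositional _≟_ using (_∈?_)

  N⇒≢ : ∀ {x y} → N x y → x ≢ y
  N⇒≢ xy x≡y = N-irrefl x≡y xy

  triangle-exit⇒ThreeNeighbours : ∀ {a b c q} → N a b → N a c → N b c →
    Star N a q → q ∉ a ∷ b ∷ c ∷ [] → ∃[ u ] ThreeNeighbours N u
  triangle-exit⇒ThreeNeighbours {a} {b} {c} ab ac bc a⇝q q∉
    with Star-exits (_∈? a ∷ b ∷ c ∷ []) a⇝q (here refl) q∉
  ... | _ , t , here refl , t∉ , at =
    a , b , c , t , ab , ac , at ,
    N⇒≢ bc , ∈∉⇒≢ (there (here refl)) t∉ , ∈∉⇒≢ (there (there (here refl))) t∉
  ... | _ , t , there (here refl) , t∉ , bt =
    b , a , c , t , N-sym ab , bc , bt ,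
    N⇒≢ ac , ∈∉⇒≢ (here refl) t∉ , ∈∉⇒≢ (there (there (here refl))) t∉
  ... | _ , t , there (there (here refl)) , t∉ , ct =
    c , a , b , t , N-sym ac , N-sym bc , ct ,
    N⇒≢ ab , ∈∉⇒≢ (here refl) t∉ , ∈∉⇒≢ (there (here refl)) t∉

WithinSteps-map : ∀ {V : Set} {D E : Digraph V} → (∀ {a b} → D a b → E a b) →
                  ∀ {z k a b} → WithinSteps D z k a b → WithinSteps E z k a b
WithinSteps-map f (here a≢z)           = here a≢z
WithinSteps-map f (step a≢z ab within) = step a≢z (f ab) (WithinSteps-map f within)

C12-map : ∀ {V : Set} {D E : Digraph V} → (∀ {a b} → D a b → E a b) →
          ∀ {u v} → C12 D u v → C12 E u v
C12-map f (u≢v , w , w≢u , w≢v , inj₁ (u⇝w , v⇝w)) =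
  u≢v , w , w≢u , w≢v , inj₁ (WithinSteps-map f u⇝w , WithinSteps-map f v⇝w)
C12-map f (u≢v , w , w≢u , w≢v , inj₂ (v⇝w , u⇝w)) =
  u≢v , w , w≢u , w≢v , inj₂ (WithinSteps-map f v⇝w , WithinSteps-map f u⇝w)

module _ {V : Set} {D : Digraph V} where

  C12-sym : Symmetric (C12 D)
  C12-sym (u≢v , w , w≢u , w≢v , inj₁ steps) = ≢-sym u≢v , w , w≢v , w≢u , inj₂ steps
  C12-sym (u≢v , w , w≢u , w≢v , inj₂ steps) = ≢-sym u≢v , w , w≢v , w≢u , inj₁ steps

  C12-irrefl : Irreflexive _≡_ (C12 D)
  C12-irrefl refl (u≢u , _) = u≢u refl

  common-out-neighbour⇒C12 : ∀ {a b t} → D a t → D b t →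
    a ≢ b → t ≢ a → t ≢ b → C12 D a b
  common-out-neighbour⇒C12 at bt a≢b t≢a t≢b =
    a≢b , _ , t≢a , t≢b ,
    inj₁ (step a≢b at (here t≢b) , step (≢-sym a≢b) bt (here t≢a))

  two-step⇒C12 : ∀ {v y w z} → D v y → D y w → D z w →
    v ≢ z → y ≢ z → w ≢ v → w ≢ z → C12 D v z
  two-step⇒C12 vy yw zw v≢z y≢z w≢v w≢z =
    v≢z , _ , w≢v , w≢z ,
    inj₂ (step (≢-sym v≢z) zw (here w≢v) , step v≢z vy (step y≢z yw (here w≢z)))

  data Competing (w : V) : Set where
    shared-prey   : ∀ {t x} → D w t → D x t → x ≢ w → Competing w
    two-step-prey : ∀ {p f p'} → D w p → D p f → D p' f → p ≢ p' → Competing w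

  C12⇒Competing : ∀ {w u} → C12 D w u → Competing w
  C12⇒Competing (_ , _ , t≢w , _ , inj₁ (here _ , _)) = ⊥-elim (t≢w refl)
  C12⇒Competing (_ , _ , _ , t≢u , inj₁ (step _ _ (here _) , here _)) = ⊥-elim (t≢u refl)
  C12⇒Competing (w≢u , _ , _ , _ , inj₁ (step _ wt (here _) , step _ ut (here _))) =
    shared-prey wt ut (≢-sym w≢u)
  C12⇒Competing
    (_ , _ , _ , _ , inj₁ (step _ wt (here _) , step _ _ (step x≢w xt (here _)))) =
    shared-prey wt xt x≢w
  C12⇒Competing (_ , _ , _ , t≢u , inj₂ (here _ , _)) = ⊥-elim (t≢u refl)
  C12⇒Competing (_ , _ , t≢w , _ , inj₂ (step _ _ (here _) , here _)) = ⊥-elim (t≢w refl)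
  C12⇒Competing (w≢u , _ , _ , _ , inj₂ (step _ ut (here _) , step _ wt (here _))) =
    shared-prey wt ut (≢-sym w≢u)
  C12⇒Competing
    (_ , _ , _ , _ , inj₂ (step _ ut (here _) , step _ wx (step x≢u xt (here _)))) =
    two-step-prey wx xt ut x≢u

  Competing⇒two-in-neighbours : ∀ {w} → Competing w →
    ∃[ t ] ∃[ y ] ∃[ z ] (D y t × D z t × y ≢ z)
  Competing⇒two-in-neighbours (shared-prey wt xt x≢w)       = _ , _ , _ , wt , xt , ≢-sym x≢w
  Competing⇒two-in-neighbours (two-step-prey _ pf p'f p≢p') = _ , _ , _ , pf , p'f , p≢p'

T-or-T-not : ∀ b → T b ⊎ T (not b)
T-or-T-not true  = inj₁ tt
T-or-T-not false = inj₂ tt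

module Bipartite {m n : ℕ} (o : Orientation m n) where

  V : Set
  V = Fin m ⊎ Fin n

  _≟_ : DecidableEquality V
  _≟_ = ≡-dec Fin._≟_ Fin._≟_

  -- A record, so that an arc determines its endpoints during unification.
  record Arc (x y : V) : Set where
    constructor arc
    field unarc : orientArc o x y
  open Arc public

  data Opposite : V → V → Set where
    left-right : ∀ {i j} → Opposite (inj₁ i) (inj₂ j)
    right-left : ∀ {i j} → Opposite (inj₂ j) (inj₁ i)

  opposite-irrefl : ∀ {x} → ¬ Opposite x x
  opposite-irrefl ()

  opposite-sym : Symmetric Opposite
  opposite-sym left-right = right-left
  opposite-sym right-left = left-right

  opposite-trans₃ : ∀ {a b c d} → Opposite a b → Opposite b c → Opposite c d → Opposite a d
  opposite-trans₃ left-right right-left left-right = left-right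
  opposite-trans₃ right-left left-right right-left = right-left

  arc⇒opposite : ∀ {x y} → Arc x y → Opposite x y
  arc⇒opposite {inj₁ _} {inj₂ _} _ = left-right
  arc⇒opposite {inj₂ _} {inj₁ _} _ = right-left
  arc⇒opposite {inj₁ _} {inj₁ _} (arc ())
  arc⇒opposite {inj₂ _} {inj₂ _} (arc ())

  opposite⇒arc : ∀ {x y} → Opposite x y → Arc x y ⊎ Arc y x
  opposite⇒arc (left-right {i} {j}) with T-or-T-not (o i j)
  ... | inj₁ ij = inj₁ (arc ij)
  ... | inj₂ ji = inj₂ (arc ji)
  opposite⇒arc (right-left {i} {j}) with T-or-T-not (o i j)
  ... | inj₁ ij = inj₂ (arc ij)
  ... | inj₂ ji = inj₁ (arc ji)

  arc⇒≢ : ∀ {x y} → Arc x y → x ≢ y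
  arc⇒≢ xy refl = opposite-irrefl (arc⇒opposite xy)

  arc-asym : ∀ {x y} → Arc x y → ¬ Arc y x
  arc-asym {inj₁ i} {inj₂ j} (arc ij) (arc ji) with o i j
  ... | true  = ji
  ... | false = ij
  arc-asym {inj₂ j} {inj₁ i} (arc ji) (arc ij) with o i j
  ... | true  = ji
  ... | false = ij
  arc-asym {inj₁ _} {inj₁ _} (arc ())
  arc-asym {inj₂ _} {inj₂ _} (arc ())

  arc-no-triangle : ∀ {a b c} → Arc a b → Arc b c → ¬ Arc a c
  arc-no-triangle ab bc ac = opposite-irrefl
    (opposite-trans₃ (arc⇒opposite ab) (arc⇒opposite bc) (opposite-sym (arc⇒opposite ac)))

  zigzag⇒joined : ∀ {w p f p'} → Arc w p → Arc p f → Arc p' f → Arc w p' ⊎ Arc p' w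
  zigzag⇒joined wp pf p'f = opposite⇒arc
    (opposite-trans₃ (arc⇒opposite wp) (arc⇒opposite pf) (opposite-sym (arc⇒opposite p'f)))

  N : V → V → Set
  N = C12 Arc

  common-out-neighbour : ∀ {a b t} → Arc a t → Arc b t → a ≢ b → N a b
  common-out-neighbour at bt a≢b =
    common-out-neighbour⇒C12 at bt a≢b (≢-sym (arc⇒≢ at)) (≢-sym (arc⇒≢ bt))

  two-step : ∀ {v y w z} → Arc v y → Arc y w → Arc z w → y ≢ z → N v z
  two-step {v} {_} {w} {z} vy yw zw y≢z =
    two-step⇒C12 vy yw zw v≢z y≢z w≢v (≢-sym (arc⇒≢ zw))
    where
    v≢z : v ≢ z
    v≢z refl = arc-no-triangle vy yw zw
    w≢v : w ≢ v
    w≢v refl = arc-asym vy yw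

  shared-prey⇒ThreeNeighbours : ∀ {y z w t x} → Arc y w → Arc z w → y ≢ z →
    Arc w t → Arc x t → x ≢ w → ThreeNeighbours N x
  shared-prey⇒ThreeNeighbours yw zw y≢z wt xt x≢w =
    _ , _ , _ ,
    common-out-neighbour xt wt x≢w ,
    C12-sym (two-step yw wt xt (≢-sym x≢w)) ,
    C12-sym (two-step zw wt xt (≢-sym x≢w)) ,
    ≢-sym (arc⇒≢ yw) , ≢-sym (arc⇒≢ zw) , y≢z

  two-step-prey⇒ThreeNeighbours : (∀ u v → Star N u v) →
    ∀ {w p f p' q} → Arc w p → Arc p f → Arc p' f → p ≢ p' → Arc q w → q ≢ p' →
    ∃[ u ] ThreeNeighbours N u
  two-step-prey⇒ThreeNeighbours connected {w} {p} {_} {p'} {q} wp pf p'f p≢p' qw q≢p'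
    with zigzag⇒joined wp pf p'f
  ... | inj₂ p'w =
    _ , _ , _ , _ ,
    common-out-neighbour p'f pf (≢-sym p≢p') ,
    C12-sym (two-step wp pf p'f p≢p') ,
    common-out-neighbour p'w qw (≢-sym q≢p') ,
    ≢-sym (arc⇒≢ wp) , p≢q , ≢-sym (arc⇒≢ qw)
    where
    p≢q : p ≢ q
    p≢q refl = arc-asym wp qw
  ... | inj₁ wp' =
    triangle-exit⇒ThreeNeighbours C12-sym C12-irrefl _≟_
      (two-step wp' p'f pf (≢-sym p≢p')) (two-step wp pf p'f p≢p')
      (common-out-neighbour pf p'f p≢p') (connected _ _) q∉
    where
    q∉ : q ∉ w ∷ p ∷ p' ∷ []
    q∉ (here refl)                 = arc⇒≢ qw refl
    q∉ (there (here refl))         = arc-asym wp qw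
    q∉ (there (there (here refl))) = q≢p' refl

  connected⇒ThreeNeighbours : Fin m → Fin n → (∀ u v → Star N u v) →
    ∃[ u ] ThreeNeighbours N u
  connected⇒ThreeNeighbours i j connected
    with Star-first (connected (inj₁ i) (inj₂ j)) (λ ())
  ... | _ , edge with Competing⇒two-in-neighbours (C12⇒Competing edge)
  ... | w , y , z , yw , zw , y≢z with Star-first (connected w y) (≢-sym (arc⇒≢ yw))
  ... | _ , wu with C12⇒Competing wu
  ... | shared-prey wt xt x≢w = _ , shared-prey⇒ThreeNeighbours yw zw y≢z wt xt x≢w
  ... | two-step-prey {p' = p'} wp pf p'f p≢p' with y ≟ p'
  ...   | yes refl  = two-step-prey⇒ThreeNeighbours connected wp pf p'f p≢p' zw (≢-sym y≢z)
  ...   | no  y≢p' = two-step-prey⇒ThreeNeighbours connected wp pf p'f p≢p' yw y≢p'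

Adj⇒∈neighbours : ∀ {k} (G : Graph k) {x y} → Adj G x y → y ∈ filterᵇ (adj G x) (allFin k)
Adj⇒∈neighbours G {x} {y} xy =
  ∈-filter⁺ {P = λ z → T (adj G x z)} (λ z → T? (adj G x z)) (∈-allFin y) xy

ThreeNeighbours⇒degree≥3 : ∀ {k} (G : Graph k) {x} →
  ThreeNeighbours (Adj G) x → degree G x ≥ 3
ThreeNeighbours⇒degree≥3 G (_ , _ , _ , xa , xb , xc , a≢b , a≢c , b≢c) =
  3≤length (Adj⇒∈neighbours G xa) (Adj⇒∈neighbours G xb) (Adj⇒∈neighbours G xc)
           a≢b a≢c b≢c

module _ {k : ℕ} (G : Graph k) {V : Set} (N : V → V → Set) (f : Fin k ↔ V) where
  open Inverse f

  Connected-transport : (∀ {x y} → Adj G x y → N (to x) (to y)) →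
    Connected G → ∀ u v → Star N u v
  Connected-transport Adj⇒N connected u v =
    subst₂ (Star N) (strictlyInverseˡ u) (strictlyInverseˡ v)
      (gmap to Adj⇒N (connected (from u) (from v)))

  ThreeNeighbours-transport : (∀ {x y} → N (to x) (to y) → Adj G x y) →
    ∀ {u} → ThreeNeighbours N u → ThreeNeighbours (Adj G) (from u)
  ThreeNeighbours-transport N⇒Adj (_ , _ , _ , ua , ub , uc , a≢b , a≢c , b≢c) =
    _ , _ , _ , pull ua , pull ub , pull uc , push a≢b , push a≢c , push b≢c
    where
    pull : ∀ {u a} → N u a → Adj G (from u) (from a)
    pull {u} {a} ua =
      N⇒Adj (subst₂ N (sym (strictlyInverseˡ u)) (sym (strictlyInverseˡ a)) ua)
    push : ∀ {a b} → a ≢ b → from a ≢ from b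
    push {a} {b} a≢b e =
      a≢b (trans (sym (strictlyInverseˡ a)) (trans (cong to e) (strictlyInverseˡ b)))

corollary3p9 : ∀ {k} (G : Graph k) → Connected G → Realizable G →
    ∃[ x ] degree G x ≥ 3
corollary3p9 G connected (_ , _ , s≤s _ , s≤s _ , o , f , adj⇔C12) =
  let u , three = connected⇒ThreeNeighbours Fin.zero Fin.zero
                    (Connected-transport G N f Adj⇒N connected)
  in  Inverse.from f u ,
      ThreeNeighbours⇒degree≥3 G (ThreeNeighbours-transport G N f N⇒Adj three)
  where
  open Bipartite o
  open Inverse f using (to)
  Adj⇒N : ∀ {x y} → Adj G x y → N (to x) (to y)
  Adj⇒N {x} {y} xy = C12-map arc (proj₁ (adj⇔C12 x y) xy)
  N⇒Adj : ∀ {x y} → N (to x) (to y) → Adj G x y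
  N⇒Adj {x} {y} xy = proj₂ (adj⇔C12 x y) (C12-map unarc xy)
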